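{- Let $n\ge 2$, let $a_0,\dots,a_n$, $b_0,\dots,b_n$, $c_1,\dots,c_n$ be nonnegative integers and set $c_0=0$. Consider the circular board with cells $0,1,\dots,n$ arranged cyclically (cell $n$ adjacent to cell $0$). Then the number of tilings of this circular board equals $A(\mathbf{a}_0^n,\mathbf{b}_0^n,\mathbf{c}_0^n)+B(\mathbf{a}_0^{n-1},\mathbf{b}_0^{n-1},\mathbf{c}_0^{n-1})$.
   Context: For $m\ge 0$, $A(\mathbf{a}_0^m,\mathbf{b}_0^m,\mathbf{c}_0^m)$ and $B(\mathbf{a}_0^m,\mathbf{b}_0^m,\mathbf{c}_0^m)$ denote the $(1,1)$- and $(2,1)$-entries of $\prod_{k=0}^{m}\begin{pmatrix} a_k & 1 & 0\\ b_k & 0 & 1\\ c'_k & 0 & 0\end{pmatrix}$ with $c'_0=1$ and $c'_k=c_k$ for $k\ge1$ (these entries do not depend on the value in the $(3,1)$ position of the first factor). A tiling of the circular board is a partition of the cells into blocks of cyclically consecutive cells of length $1$, $2$ or $3$, each block with a chosen stack height: a block $\{i\}$ has $a_i$ choices; a block $\{i-1,i\}$ (indices mod $n+1$, so $\{n,0\}$ corresponds to $i=0$) has $b_i$ choices; a block $\{i-2,i-1,i\}$ (indices mod $n+1$; so $\{n-1,n,0\}$ corresponds to $i=0$ and $\{n,0,1\}$ to $i=1$) has $c_i$ choices. The number of tilings is the sum over such partitions of the product of these numbers; since $c_0=0$, bars covering $\{n-1,n,0\}$ are forbidden. -}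

module Defs where

open import Data.Nat using (ℕ; zero; suc; _+_; _*_; _∸_; _<ᵇ_; _≡ᵇ_)
open import Data.Nat.DivMod using (_%_)
open import Data.Bool using (Bool; true; false; if_then_else_; _∧_)
open import Data.List using (List; []; _∷_; map; concatMap; upTo; foldr; length)
open import Data.Nat.ListAction using (sum; product)
open import Data.Product using (_×_; _,_)
open import Data.Fin using (Fin; zero; suc)

Mat : Set
Mat = Fin 3 → Fin 3 → ℕ

_⊗_ : Mat → Mat → Mat
(X ⊗ Y) i j = X i zero * Y zero j + (X i (suc zero) * Y (suc zero) j + X i (suc (suc zero)) * Y (suc (suc zero)) j)

c′ : (ℕ → ℕ) → ℕ → ℕ
c′ c zero    = 1
c′ c (suc k) = c (suc k)

factor : (a b c : ℕ → ℕ) → ℕ → Mat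
factor a b c k zero zero                     = a k
factor a b c k zero (suc zero)               = 1
factor a b c k zero (suc (suc zero))         = 0
factor a b c k (suc zero) zero               = b k
factor a b c k (suc zero) (suc zero)         = 0
factor a b c k (suc zero) (suc (suc zero))   = 1
factor a b c k (suc (suc zero)) zero         = c′ c k
factor a b c k (suc (suc zero)) (suc _)      = 0

prodM : (a b c : ℕ → ℕ) → ℕ → Mat
prodM a b c zero    = factor a b c zero
prodM a b c (suc m) = prodM a b c m ⊗ factor a b c (suc m)

A : (a b c : ℕ → ℕ) → ℕ → ℕ
A a b c m = prodM a b c m zero zero

B : (a b c : ℕ → ℕ) → ℕ → ℕ
B a b c m = prodM a b c m (suc zero) zero

-- A block ("arc") is a pair (i , l) with 0 ≤ i ≤ n and l ∈ {1,2,3}: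
-- it consists of the cells i, i-1, …, i-l+1 (indices mod N).

Arc : Set
Arc = ℕ × ℕ

allArcs : ℕ → List Arc
allArcs n = concatMap (λ i → (i , 1) ∷ (i , 2) ∷ (i , 3) ∷ []) (upTo (suc n))

covers : ℕ → Arc → ℕ → Bool
covers n (i , l) j = ((i + suc n ∸ j) % suc n) <ᵇ l

coverCount : ℕ → List Arc → ℕ → ℕ
coverCount n S j = length (Data.List.filterᵇ (λ x → covers n x j) S)

isTiling : ℕ → List Arc → Bool
isTiling n S = foldr (λ j r → (coverCount n S j ≡ᵇ 1) ∧ r) true (upTo (suc n))

subsets : {X : Set} → List X → List (List X)
subsets []       = [] ∷ []
subsets (x ∷ xs) = let r = subsets xs in r Data.List.++ map (x ∷_) r

-- number of stack-height choices for an arc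
weight : (a b c : ℕ → ℕ) → Arc → ℕ
weight a b c (i , 1) = a i
weight a b c (i , 2) = b i
weight a b c (i , _) = c i

tilings : (a b c : ℕ → ℕ) → ℕ → ℕ
tilings a b c n =
  sum (map (λ S → product (map (weight a b c) S))
           (Data.List.filterᵇ (isTiling n) (subsets (allArcs n))))

-- Summing over subsets of the blocks one block at a time turns the number of tilings into a
-- decision tree, with the blocks listed by their last cell 0, 1, …, n.  Once the blocks ending
-- before cell s are decided, only cells s − 2 and s − 1 are still open (besides cell n, which a
-- block through n and 0 may already cover), and for s ≥ 2 the choice of the block ending at s acts
-- on these boundary states as the factor M_s.  Hence the blocks ending at cells 2, …, n contribute
-- M_2 ⋯ M_n applied to a terminal vector; since c_0 = 0, the blocks ending at cells 0 and 1 either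
-- avoid cell n, giving A(n), or contain both n and 0, giving B(n − 1) because M_n e₂ = e₁.

module Submission where

open import Defs
open import Data.Nat using (ℕ; zero; suc; _+_; _*_; _∸_; _≤_; _<_; _<ᵇ_; _≡ᵇ_; s≤s; z≤n)
open import Data.Nat.Properties
open import Data.Bool using (Bool; true; false; if_then_else_; _∧_)
open import Data.List using (List; []; _∷_; map; foldr; upTo; applyUpTo; _++_; filterᵇ; length; concatMap)
open import Data.List.Properties using (map-++; map-∘; map-cong)
open import Data.List.Relation.Unary.All using (All; []; _∷_)
open import Data.List.Relation.Unary.Any using (Any; here; there)
import Data.List.Relation.Unary.All.Properties as All
import Data.List.Relation.Unary.Any.Properties as Any
open import Data.Nat.DivMod using (_%_; [m+n]%n≡m%n; m<n⇒m%n≡m)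
open import Data.Fin using (Fin; zero; suc)
open import Data.Maybe using (Maybe; just; nothing; maybe′)
open import Data.Product using (_×_; _,_; proj₁; proj₂; uncurry)
open import Data.Nat.Tactic.RingSolver using (solve-∀)
open import Data.Nat.ListAction using (sum; product)
open import Data.Nat.ListAction.Properties using (sum-++)
open import Function using (_∘_)
open import Relation.Nullary using (contradiction)
open import Data.Sum using (inj₁; inj₂)
open import Data.Bool.Properties using (∧-zeroʳ)
open import Relation.Binary.PropositionalEquality
open ≡-Reasoning
open import Algebra.Properties.CommutativeSemigroup +-commutativeSemigroup using (xy∙z≈xz∙y)

bit : Bool → ℕ
bit false = 0
bit true  = 1

sum-filterᵇ : {X : Set} (p : X → Bool) (g : X → ℕ) (xs : List X) →
  sum (map g (filterᵇ p xs)) ≡ sum (map (λ x → if p x then g x else 0) xs)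
sum-filterᵇ p g [] = refl
sum-filterᵇ p g (x ∷ xs) with p x
... | true  = cong (g x +_) (sum-filterᵇ p g xs)
... | false = sum-filterᵇ p g xs

sum-map-*ˡ : {X : Set} (k : ℕ) (g : X → ℕ) (xs : List X) →
  sum (map (λ x → k * g x) xs) ≡ k * sum (map g xs)
sum-map-*ˡ k g [] = sym (*-zeroʳ k)
sum-map-*ˡ k g (x ∷ xs) = begin
  k * g x + sum (map (λ x → k * g x) xs) ≡⟨ cong (k * g x +_) (sum-map-*ˡ k g xs) ⟩
  k * g x + k * sum (map g xs)           ≡⟨ *-distribˡ-+ k (g x) _ ⟨
  k * (g x + sum (map g xs))             ∎

module ExactCovers {X : Set} (n : ℕ) (covers : X → ℕ → Bool) (w : X → ℕ) where

  allOne : (ℕ → ℕ) → List ℕ → Bool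
  allOne mult = foldr (λ j r → (mult j ≡ᵇ 1) ∧ r) true

  allOne-cong : ∀ {f g} {js} → All (λ j → f j ≡ g j) js → allOne f js ≡ allOne g js
  allOne-cong []       = refl
  allOne-cong (e ∷ es) = cong₂ _∧_ (cong (_≡ᵇ 1) e) (allOne-cong es)

  allOne-true : ∀ {f} {js} → All (λ j → f j ≡ 1) js → allOne f js ≡ true
  allOne-true []       = refl
  allOne-true (e ∷ es) rewrite e = allOne-true es

  allOne-false : ∀ {f} {js} → Any (λ j → f j ≢ 1) js → allOne f js ≡ false
  allOne-false {f} {j ∷ _} (here f≢1) with f j
  ... | 0           = refl
  ... | 1           = contradiction refl f≢1
  ... | suc (suc _) = refl
  allOne-false {f} {j ∷ _} (there any) rewrite allOne-false any = ∧-zeroʳ (f j ≡ᵇ 1)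

  exact : (ℕ → ℕ) → Bool
  exact mult = allOne mult (upTo (suc n))

  all-cells : ∀ {P : ℕ → Set} → (∀ j → j ≤ n → P j) → All P (upTo (suc n))
  all-cells P = All.applyUpTo⁺₁ (λ j → j) (suc n) (λ j<1+n → P _ (≤-pred j<1+n))

  exact-cong : ∀ {f g} → (∀ j → j ≤ n → f j ≡ g j) → exact f ≡ exact g
  exact-cong {f} {g} f≗g = allOne-cong {f} {g} (all-cells f≗g)

  exact-true : ∀ {f} → (∀ j → j ≤ n → f j ≡ 1) → exact f ≡ true
  exact-true {f} ones = allOne-true {f} (all-cells ones)

  exact-false : ∀ {f} j → j ≤ n → f j ≢ 1 → exact f ≡ false
  exact-false {f} j j≤n f≢1 = allOne-false {f} (Any.applyUpTo⁺ (λ j → j) f≢1 (s≤s j≤n))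

  multiplicity : List X → ℕ → ℕ
  multiplicity S j = length (filterᵇ (λ x → covers x j) S)

  infixl 6 _⊕_
  _⊕_ : (ℕ → ℕ) → X → ℕ → ℕ
  (mult ⊕ x) j = mult j + bit (covers x j)

  count : List X → (ℕ → ℕ) → ℕ
  count []       mult = bit (exact mult)
  count (x ∷ xs) mult = count xs mult + w x * count xs (mult ⊕ x)

  multiplicity-∷ : ∀ x S j → multiplicity (x ∷ S) j ≡ bit (covers x j) + multiplicity S j
  multiplicity-∷ x S j with covers x j
  ... | true  = refl
  ... | false = refl

  weightIfExact : (ℕ → ℕ) → List X → ℕ
  weightIfExact mult S = if exact (λ j → mult j + multiplicity S j) then product (map w S) else 0

  weightIfExact-∷ : ∀ mult x S → weightIfExact mult (x ∷ S) ≡ w x * weightIfExact (mult ⊕ x) S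
  weightIfExact-∷ mult x S rewrite exact-cong {g = λ j → (mult ⊕ x) j + multiplicity S j}
      (λ j _ → trans (cong (mult j +_) (multiplicity-∷ x S j)) (sym (+-assoc (mult j) _ _)))
    with exact (λ j → (mult ⊕ x) j + multiplicity S j)
  ... | true  = refl
  ... | false = sym (*-zeroʳ (w x))

  sum-weightIfExact : ∀ L mult → sum (map (weightIfExact mult) (subsets L)) ≡ count L mult
  sum-weightIfExact [] mult rewrite exact-cong {g = mult} (λ j _ → +-identityʳ (mult j)) with exact mult
  ... | true  = refl
  ... | false = refl
  sum-weightIfExact (x ∷ xs) mult = begin
    sum (map F (subsets xs ++ map (x ∷_) (subsets xs)))
      ≡⟨ cong sum (map-++ F (subsets xs) _) ⟩
    sum (map F (subsets xs) ++ map F (map (x ∷_) (subsets xs)))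
      ≡⟨ sum-++ (map F (subsets xs)) _ ⟩
    sum (map F (subsets xs)) + sum (map F (map (x ∷_) (subsets xs)))
      ≡⟨ cong (sum (map F (subsets xs)) +_) (cong sum (begin
           map F (map (x ∷_) (subsets xs))      ≡⟨ map-∘ (subsets xs) ⟨
           map (F ∘ (x ∷_)) (subsets xs)        ≡⟨ map-cong (weightIfExact-∷ mult x) (subsets xs) ⟩
           map (λ S → w x * F⊕ S) (subsets xs) ∎)) ⟩
    sum (map F (subsets xs)) + sum (map (λ S → w x * F⊕ S) (subsets xs))
      ≡⟨ cong₂ _+_ (sum-weightIfExact xs mult) (sum-map-*ˡ (w x) F⊕ (subsets xs)) ⟩
    count xs mult + w x * sum (map F⊕ (subsets xs))
      ≡⟨ cong (λ t → count xs mult + w x * t) (sum-weightIfExact xs (mult ⊕ x)) ⟩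
    count (x ∷ xs) mult ∎
    where
      F F⊕ : List X → ℕ
      F  = weightIfExact mult
      F⊕ = weightIfExact (mult ⊕ x)

  count-correct : ∀ L →
    sum (map (product ∘ map w) (filterᵇ (exact ∘ multiplicity) (subsets L))) ≡ count L (λ _ → 0)
  count-correct L = trans (sum-filterᵇ (exact ∘ multiplicity) (product ∘ map w) (subsets L))
                        (sum-weightIfExact L (λ _ → 0))

  count-cong : ∀ L {f g} → (∀ j → j ≤ n → f j ≡ g j) → count L f ≡ count L g
  count-cong []       f≗g = cong bit (exact-cong f≗g)
  count-cong (x ∷ xs) f≗g = cong₂ (λ p q → p + w x * q) (count-cong xs f≗g)
    (count-cong xs (λ j j≤n → cong (_+ bit (covers x j)) (f≗g j j≤n)))

  count-overlap : ∀ L {f} j → j ≤ n → 2 ≤ f j → count L f ≡ 0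
  count-overlap []       {f} j j≤n 2≤fj =
    cong bit (exact-false {f} j j≤n (λ fj≡1 → 1+n≰n (subst (2 ≤_) fj≡1 2≤fj)))
  count-overlap (x ∷ xs) j j≤n 2≤fj = begin
    count xs _ + w x * count xs _ ≡⟨ cong₂ (λ p q → p + w x * q) (count-overlap xs j j≤n 2≤fj)
                                       (count-overlap xs j j≤n (≤-trans 2≤fj (m≤m+n _ _))) ⟩
    w x * 0                       ≡⟨ *-zeroʳ (w x) ⟩
    0                             ∎

  count-uncovered : ∀ L {f} j → j ≤ n → f j ≢ 1 → All (λ x → covers x j ≡ false) L → count L f ≡ 0
  count-uncovered []       {f} j j≤n fj≢1 []             = cong bit (exact-false {f} j j≤n fj≢1)
  count-uncovered (x ∷ xs) {f} j j≤n fj≢1 (x∌j ∷ xs∌j) = begin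
    count xs f + w x * count xs (f ⊕ x) ≡⟨ cong₂ (λ p q → p + w x * q) (count-uncovered xs j j≤n fj≢1 xs∌j)
                                             (count-uncovered xs j j≤n (fj≢1 ∘ trans (sym unchanged)) xs∌j) ⟩
    w x * 0                             ≡⟨ *-zeroʳ (w x) ⟩
    0                                   ∎
    where
      unchanged : (f ⊕ x) j ≡ f j
      unchanged = trans (cong (λ b → f j + bit b) x∌j) (+-identityʳ (f j))

  count-skip : ∀ xs L {f} j → j ≤ n → 1 ≤ f j → All (λ x → covers x j ≡ true) xs →
    count (xs ++ L) f ≡ count L f
  count-skip []       L j j≤n 1≤fj []             = refl
  count-skip (x ∷ xs) L {f} j j≤n 1≤fj (x∋j ∷ xs∋j) = begin
    count (xs ++ L) f + w x * count (xs ++ L) (f ⊕ x) ≡⟨ cong₂ (λ p q → p + w x * q) (count-skip xs L j j≤n 1≤fj xs∋j)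
                                                           (count-overlap (xs ++ L) j j≤n twice) ⟩
    count L f + w x * 0                               ≡⟨ cong (count L f +_) (*-zeroʳ (w x)) ⟩
    count L f + 0                                     ≡⟨ +-identityʳ (count L f) ⟩
    count L f                                         ∎
    where
      twice : 2 ≤ (f ⊕ x) j
      twice = subst (λ b → 2 ≤ f j + bit b) (sym x∋j) (subst (2 ≤_) (+-comm 1 (f j)) (s≤s 1≤fj))

  count-exclusive : ∀ xs L {f} j → j ≤ n → All (λ x → covers x j ≡ true) xs →
    count (xs ++ L) f ≡ count L f + sum (map (λ x → w x * count L (f ⊕ x)) xs)
  count-exclusive []       L {f} j j≤n []             = sym (+-identityʳ (count L f))
  count-exclusive (x ∷ xs) L {f} j j≤n (x∋j ∷ xs∋j) = begin
    count (xs ++ L) f + w x * count (xs ++ L) (f ⊕ x)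
      ≡⟨ cong₂ (λ p q → p + w x * q) (count-exclusive xs L j j≤n xs∋j) (count-skip xs L j j≤n covered xs∋j) ⟩
    (count L f + rest) + w x * count L (f ⊕ x)
      ≡⟨ +-assoc (count L f) rest _ ⟩
    count L f + (rest + w x * count L (f ⊕ x))
      ≡⟨ cong (count L f +_) (+-comm rest _) ⟩
    count L f + (w x * count L (f ⊕ x) + rest) ∎
    where
      rest : ℕ
      rest = sum (map (λ y → w y * count L (f ⊕ y)) xs)
      covered : 1 ≤ (f ⊕ x) j
      covered = subst (λ b → 1 ≤ f j + bit b) (sym x∋j) (subst (1 ≤_) (+-comm 1 (f j)) (s≤s z≤n))

Vec3 : Set
Vec3 = ℕ × ℕ × ℕ

row : Mat → Fin 3 → Vec3 → ℕ
row X i (x , y , z) = X i zero * x + (X i (suc zero) * y + X i (suc (suc zero)) * z)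

act : Mat → Vec3 → Vec3
act X v = row X zero v , row X (suc zero) v , row X (suc (suc zero)) v

act-⊗ : ∀ X Y v → act (X ⊗ Y) v ≡ act X (act Y v)
act-⊗ X Y (x , y , z) = cong₂ _,_ (row-⊗ zero) (cong₂ _,_ (row-⊗ (suc zero)) (row-⊗ (suc (suc zero))))
  where
    sum-swap : ∀ p q r y₀₀ y₀₁ y₀₂ y₁₀ y₁₁ y₁₂ y₂₀ y₂₁ y₂₂ x y z →
      (p * y₀₀ + (q * y₁₀ + r * y₂₀)) * x
        + ((p * y₀₁ + (q * y₁₁ + r * y₂₁)) * y + (p * y₀₂ + (q * y₁₂ + r * y₂₂)) * z)
      ≡ p * (y₀₀ * x + (y₀₁ * y + y₀₂ * z))
        + (q * (y₁₀ * x + (y₁₁ * y + y₁₂ * z)) + r * (y₂₀ * x + (y₂₁ * y + y₂₂ * z)))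
    sum-swap = solve-∀
    row-⊗ : ∀ i → row (X ⊗ Y) i (x , y , z) ≡ row X i (act Y (x , y , z))
    row-⊗ i = sum-swap (X i zero) (X i (suc zero)) (X i (suc (suc zero)))
      (Y zero zero) (Y zero (suc zero)) (Y zero (suc (suc zero)))
      (Y (suc zero) zero) (Y (suc zero) (suc zero)) (Y (suc zero) (suc (suc zero)))
      (Y (suc (suc zero)) zero) (Y (suc (suc zero)) (suc zero)) (Y (suc (suc zero)) (suc (suc zero))) x y z

act-first-column : ∀ X → act X (1 , 0 , 0) ≡ (X zero zero , X (suc zero) zero , X (suc (suc zero)) zero)
act-first-column X = cong₂ _,_ (entry zero) (cong₂ _,_ (entry (suc zero)) (entry (suc (suc zero))))
  where
    picks : ∀ p q r → p * 1 + (q * 0 + r * 0) ≡ p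
    picks = solve-∀
    entry : ∀ i → row X i (1 , 0 , 0) ≡ X i zero
    entry i = picks (X i zero) (X i (suc zero)) (X i (suc (suc zero)))

-- Coordinates of a vector indexed by the boundary state (u , v); the state (false , true) never occurs.
coord : Vec3 → Bool → Bool → ℕ
coord (x , _ , _) true  true  = x
coord (_ , y , _) true  false = y
coord (_ , _ , z) false false = z
coord _           false true  = 0

-- (u , v) says whether cells s − 2 and s − 1 are covered when a block of length l ending at cell s
-- (no block if l = 0) is placed; afterwards cell s − 2 can no longer be covered, so it must be
-- covered exactly once.
place : ℕ → Bool → Bool → Maybe (Bool × Bool)
place 0 true  v     = just (v , false)
place 1 true  v     = just (v , true)
place 2 true  false = just (true , true)
place 3 false false = just (true , true)
place _ _     _     = nothing

value : Vec3 → Maybe (Bool × Bool) → ℕ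
value X = maybe′ (uncurry (coord X)) 0

module Factors (a b c : ℕ → ℕ) where

  M : ℕ → Mat
  M = factor a b c

  applyFactors : ℕ → ℕ → Vec3 → Vec3
  applyFactors s zero    v = v
  applyFactors s (suc d) v = act (M s) (applyFactors (suc s) d v)

  applyFactors-snoc : ∀ s d v → applyFactors s (suc d) v ≡ applyFactors s d (act (M (s + d)) v)
  applyFactors-snoc s zero    v = cong (λ t → act (M t) v) (sym (+-identityʳ s))
  applyFactors-snoc s (suc d) v = cong (act (M s)) (begin
    applyFactors (suc s) (suc d) v                   ≡⟨ applyFactors-snoc (suc s) d v ⟩
    applyFactors (suc s) d (act (M (suc s + d)) v)   ≡⟨ cong (λ t → applyFactors (suc s) d (act (M t) v)) (+-suc s d) ⟨
    applyFactors (suc s) d (act (M (s + suc d)) v)   ∎)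

  act-prodM : ∀ m v → act (prodM a b c m) v ≡ applyFactors 0 (suc m) v
  act-prodM zero    v = refl
  act-prodM (suc m) v = begin
    act (prodM a b c m ⊗ M (suc m)) v             ≡⟨ act-⊗ (prodM a b c m) (M (suc m)) v ⟩
    act (prodM a b c m) (act (M (suc m)) v)       ≡⟨ act-prodM m (act (M (suc m)) v) ⟩
    applyFactors 0 (suc m) (act (M (suc m)) v)    ≡⟨ applyFactors-snoc 0 (suc m) v ⟨
    applyFactors 0 (suc (suc m)) v                ∎

  act-factor-second-basis : ∀ s → act (M (suc s)) (0 , 1 , 0) ≡ (1 , 0 , 0)
  act-factor-second-basis s rewrite *-zeroʳ (a (suc s)) | *-zeroʳ (b (suc s)) | *-zeroʳ (c (suc s)) = refl

  coord-factor : ∀ s X u v → coord (act (M (suc s)) X) u v ≡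
    value X (place 0 u v) + (a (suc s) * value X (place 1 u v)
      + (b (suc s) * value X (place 2 u v) + (c (suc s) * value X (place 3 u v) + 0)))
  coord-factor s (x , y , z) true  true  = tt (a (suc s)) (b (suc s)) (c (suc s)) x y z
    where
      tt : ∀ α β γ x y z → α * x + (1 * y + 0 * z) ≡ y + (α * x + (β * 0 + (γ * 0 + 0)))
      tt = solve-∀
  coord-factor s (x , y , z) true  false = tf (a (suc s)) (b (suc s)) (c (suc s)) x y z
    where
      tf : ∀ α β γ x y z → β * x + (0 * y + 1 * z) ≡ z + (α * 0 + (β * x + (γ * 0 + 0)))
      tf = solve-∀
  coord-factor s (x , y , z) false false = ff (a (suc s)) (b (suc s)) (c (suc s)) x y z
    where
      ff : ∀ α β γ x y z → γ * x + (0 * y + 0 * z) ≡ 0 + (α * 0 + (β * 0 + (γ * x + 0)))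
      ff = solve-∀
  coord-factor s (x , y , z) false true  = sym (ft (a (suc s)) (b (suc s)) (c (suc s)))
    where
      ft : ∀ α β γ → 0 + (α * 0 + (β * 0 + (γ * 0 + 0))) ≡ 0
      ft = solve-∀

<ᵇ-false : ∀ {m l} → l ≤ m → (m <ᵇ l) ≡ false
<ᵇ-false {l = zero}      _         = refl
<ᵇ-false {suc m} {suc l} (s≤s l≤m) = <ᵇ-false l≤m

covers-behind : ∀ n {i} j d l → j + d ≡ i → i ≤ n → covers n (i , l) j ≡ (d <ᵇ l)
covers-behind n j d l refl i≤n = cong (_<ᵇ l) (begin
  (j + d + suc n ∸ j) % suc n   ≡⟨ cong (λ t → (t ∸ j) % suc n) (+-assoc j d (suc n)) ⟩
  (j + (d + suc n) ∸ j) % suc n ≡⟨ cong (_% suc n) (m+n∸m≡n j (d + suc n)) ⟩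
  (d + suc n) % suc n           ≡⟨ [m+n]%n≡m%n d (suc n) ⟩
  d % suc n                     ≡⟨ m<n⇒m%n≡m (s≤s (m+n≤o⇒n≤o j i≤n)) ⟩
  d                             ∎)

covers-ahead : ∀ n i t l → covers n (i , l) (i + suc t) ≡ ((n ∸ t) <ᵇ l)
covers-ahead n i t l = cong (_<ᵇ l) (begin
  (i + suc n ∸ (i + suc t)) % suc n ≡⟨ cong (_% suc n) ([m+n]∸[m+o]≡n∸o i (suc n) (suc t)) ⟩
  (n ∸ t) % suc n                   ≡⟨ m<n⇒m%n≡m (s≤s (m∸n≤m n t)) ⟩
  n ∸ t                             ∎)

arcsAt : ℕ → List Arc
arcsAt i = (i , 1) ∷ (i , 2) ∷ (i , 3) ∷ []

columns : ℕ → ℕ → List Arc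
columns s zero    = []
columns s (suc d) = arcsAt s ++ columns (suc s) d

concatMap-arcsAt : ∀ f s d → (∀ i → f i ≡ s + i) → concatMap arcsAt (applyUpTo f d) ≡ columns s d
concatMap-arcsAt f s zero    _   = refl
concatMap-arcsAt f s (suc d) f≗ = cong₂ _++_ (cong arcsAt (trans (f≗ 0) (+-identityʳ s)))
  (concatMap-arcsAt (f ∘ suc) (suc s) d (λ i → trans (f≗ (suc i)) (+-suc s i)))

allArcs-columns : ∀ n → allArcs n ≡ columns 0 (suc n)
allArcs-columns n = concatMap-arcsAt (λ i → i) 0 (suc n) (λ _ → refl)

arcsAt-cover-end : ∀ n s → s ≤ n → All (λ x → covers n x s ≡ true) (arcsAt s)
arcsAt-cover-end n s s≤n = end 0 ∷ end 1 ∷ end 2 ∷ []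
  where
    end : ∀ l → covers n (s , suc l) s ≡ true
    end l = covers-behind n s 0 (suc l) (+-identityʳ s) s≤n

columns-avoid : ∀ n j s d → 3 + j ≤ s → s + d ≤ suc n → All (λ x → covers n x j ≡ false) (columns s d)
columns-avoid n j s zero    _     _          = []
columns-avoid n j s (suc d) 3+j≤s s+d<1+n = All.++⁺ (far 1 (s≤s z≤n) ∷ far 2 (s≤s (s≤s z≤n)) ∷ far 3 ≤-refl ∷ [])
  (columns-avoid n j (suc s) d (m≤n⇒m≤1+n 3+j≤s) s+d<n)
  where
    s+d<n : suc s + d ≤ suc n
    s+d<n = subst (_≤ suc n) (+-suc s d) s+d<1+n
    far : ∀ l → l ≤ 3 → covers n (s , l) j ≡ false
    far l l≤3 = trans (covers-behind n j (s ∸ j) l (m+[n∸m]≡n (m+n≤o⇒n≤o 3 3+j≤s)) (m+n≤o⇒m≤o s (≤-pred s+d<n)))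
                      (<ᵇ-false (≤-trans l≤3 (m+n≤o⇒m≤o∸n 3 3+j≤s)))

frontier : ℕ → Bool → Bool → ℕ → ℕ
frontier zero    u v zero          = bit u
frontier zero    u v (suc zero)    = bit v
frontier zero    u v (suc (suc _)) = 0
frontier (suc k) u v zero          = 1
frontier (suc k) u v (suc j)       = frontier k u v j

frontier-below : ∀ {k j} u v → j < k → frontier k u v j ≡ 1
frontier-below {suc k} {zero}  u v _         = refl
frontier-below {suc k} {suc j} u v (s≤s j<k) = frontier-below u v j<k

frontier-at : ∀ k u v → frontier k u v k ≡ bit u
frontier-at zero    u v = refl
frontier-at (suc k) u v = frontier-at k u v

frontier-next : ∀ k u v → frontier k u v (suc k) ≡ bit v
frontier-next zero    u v = refl
frontier-next (suc k) u v = frontier-next k u v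

pointAt : ℕ → ℕ → ℕ → ℕ
pointAt zero    x zero    = x
pointAt zero    x (suc _) = 0
pointAt (suc i) x zero    = 0
pointAt (suc i) x (suc j) = pointAt i x j

pointAt-self : ∀ i x → pointAt i x i ≡ x
pointAt-self zero    x = refl
pointAt-self (suc i) x = pointAt-self i x

pointAt-below : ∀ {i j} x → j < i → pointAt i x j ≡ 0
pointAt-below {suc i} {zero}  x _         = refl
pointAt-below {suc i} {suc j} x (s≤s j<i) = pointAt-below x j<i

frontier-advance : ∀ n k {u v u′ l} → 2 + k ≤ n → l ≤ 3 →
  bit u + bit (2 <ᵇ l) ≡ 1 → bit v + bit (1 <ᵇ l) ≡ bit u′ →
  ∀ j → j ≤ n → frontier k u v j + bit (covers n (2 + k , l) j) ≡ frontier (suc k) u′ (0 <ᵇ l) j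
frontier-advance n zero {l = l} 2≤n l≤3 cell₀ cell₁ 0 _
  rewrite covers-behind n 0 2 l refl 2≤n = cell₀
frontier-advance n zero {l = l} 2≤n l≤3 cell₀ cell₁ 1 _
  rewrite covers-behind n 1 1 l refl 2≤n = cell₁
frontier-advance n zero {l = l} 2≤n l≤3 cell₀ cell₁ 2 _
  rewrite covers-behind n 2 0 l refl 2≤n = refl
frontier-advance n zero {l = l} 2≤n l≤3 cell₀ cell₁ (suc (suc (suc t))) 3+t≤n
  rewrite covers-ahead n 2 t l | <ᵇ-false {n ∸ t} (≤-trans l≤3 (m+n≤o⇒m≤o∸n 3 3+t≤n)) = refl
frontier-advance n (suc k) {l = l} 3+k≤n l≤3 cell₀ cell₁ zero _
  rewrite covers-behind n 0 (3 + k) l refl 3+k≤n | <ᵇ-false {3 + k} (≤-trans l≤3 (m≤m+n 3 k)) = refl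
frontier-advance n (suc k) 3+k≤n l≤3 cell₀ cell₁ (suc j) j<n =
  frontier-advance n k (≤-trans (n≤1+n _) 3+k≤n) l≤3 cell₀ cell₁ j (≤-trans (n≤1+n j) j<n)

-- coord (terminal q) u v is 1 exactly when cells n − 1 and n end up covered once,
-- cell n being covered by a wrapping block iff q.
terminal : Bool → Vec3
terminal false = 1 , 0 , 0
terminal true  = 0 , 1 , 0

coord-terminal-uncovered : ∀ q v → coord (terminal q) false v ≡ 0
coord-terminal-uncovered false false = refl
coord-terminal-uncovered false true  = refl
coord-terminal-uncovered true  false = refl
coord-terminal-uncovered true  true  = refl

module Circular (a b c : ℕ → ℕ) (n : ℕ) where

  open ExactCovers n (covers n) (weight a b c) public
  open Factors a b c public

  -- Multiplicities once the blocks ending at cells 0 … k + 1 are chosen: every cell below k once,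
  -- cells k and k + 1 as recorded by u and v, and cell n once more if q (a block wrapping around from 0).
  state : ℕ → Bool → Bool → Bool → ℕ → ℕ
  state k u v q j = frontier k u v j + pointAt n (bit q) j

  state-below : ∀ {k j} u v q → j < k → k < n → state k u v q j ≡ 1
  state-below u v q j<k k<n = cong₂ _+_ (frontier-below u v j<k) (pointAt-below (bit q) (<-trans j<k k<n))

  state-at : ∀ k u v q → k < n → state k u v q k ≡ bit u
  state-at k u v q k<n = trans (cong₂ _+_ (frontier-at k u v) (pointAt-below (bit q) k<n)) (+-identityʳ (bit u))

  state-next : ∀ k u v q → suc k < n → state k u v q (suc k) ≡ bit v
  state-next k u v q k+1<n = trans (cong₂ _+_ (frontier-next k u v) (pointAt-below (bit q) k+1<n)) (+-identityʳ (bit v))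

  state-last : ∀ k u v q → suc k ≡ n → state k u v q (suc k) ≡ bit v + bit q
  state-last k u v q refl = cong₂ _+_ (frontier-next k u v) (pointAt-self (suc k) (bit q))

  state-exact : ∀ k v q → suc k ≡ n → bit v + bit q ≡ 1 → ∀ j → j ≤ n → state k true v q j ≡ 1
  state-exact k v q refl v+q≡1 j j≤n with m≤n⇒m<n∨m≡n j≤n
  ... | inj₂ refl = trans (state-last k true v q refl) v+q≡1
  ... | inj₁ j<n with m≤n⇒m<n∨m≡n (≤-pred j<n)
  ...   | inj₂ refl = state-at k true v q ≤-refl
  ...   | inj₁ j<k  = state-below true v q j<k ≤-refl

  count-state-base : ∀ k q → suc k ≡ n → ∀ u v → count [] (state k u v q) ≡ coord (terminal q) u v
  count-state-base k q     e false v =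
    trans (cong bit (exact-false {state k false v q} k (<⇒≤ k<n) (0≢1+n ∘ trans (sym (state-at k false v q k<n)))))
          (sym (coord-terminal-uncovered q v))
    where
      k<n : k < n
      k<n = ≤-reflexive e
  count-state-base k false e true true  = cong bit (exact-true {state k true true false} (state-exact k true false e refl))
  count-state-base k true  e true false = cong bit (exact-true {state k true false true} (state-exact k false true e refl))
  count-state-base k false e true false =
    cong bit (exact-false {state k true false false} (suc k) (≤-reflexive e)
      (0≢1+n ∘ trans (sym (state-last k true false false e))))
  count-state-base k true  e true true  =
    cong bit (exact-false {state k true true true} (suc k) (≤-reflexive e)
      (1+n≢0 ∘ suc-injective ∘ trans (sym (state-last k true true true e))))

  module ColumnStep (k d : ℕ) (q : Bool) (X : Vec3) (2+k+d≡n : 2 + k + d ≡ n)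
    (next : ∀ u v → count (columns (3 + k) d) (state (suc k) u v q) ≡ coord X u v) where

    s : ℕ
    s = 2 + k

    L : List Arc
    L = columns (suc s) d

    s≤n : s ≤ n
    s≤n = subst (s ≤_) 2+k+d≡n (m≤m+n s d)

    k<n : k < n
    k<n = ≤-trans (n≤1+n _) s≤n

    advance : ∀ {l u v u′} → l ≤ 3 → bit u + bit (2 <ᵇ l) ≡ 1 → bit v + bit (1 <ᵇ l) ≡ bit u′ →
              count L (state k u v q ⊕ (s , l)) ≡ coord X u′ (0 <ᵇ l)
    advance {l} {u} {v} {u′} l≤3 cell-k cell-k+1 = trans (count-cong L shifted) (next u′ (0 <ᵇ l))
      where
        shifted : ∀ j → j ≤ n → (state k u v q ⊕ (s , l)) j ≡ state (suc k) u′ (0 <ᵇ l) q j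
        shifted j j≤n = trans (xy∙z≈xz∙y (frontier k u v j) _ _)
          (cong (_+ pointAt n (bit q) j) (frontier-advance n k s≤n l≤3 cell-k cell-k+1 j j≤n))

    stuck : ∀ l {u v} → bit u + bit (2 <ᵇ l) ≢ 1 → count L (state k u v q ⊕ (s , l)) ≡ 0
    stuck l {u} {v} ≢1 = count-uncovered L k (<⇒≤ k<n) (≢1 ∘ trans (sym cell-k))
      (columns-avoid n k (suc s) d ≤-refl (≤-reflexive (cong suc 2+k+d≡n)))
      where
        cell-k : (state k u v q ⊕ (s , l)) k ≡ bit u + bit (2 <ᵇ l)
        cell-k = cong₂ _+_ (state-at k u v q k<n) (cong bit (covers-behind n k 2 l (+-comm k 2) s≤n))

    clash : ∀ l {u v} → 2 ≤ bit v + bit (1 <ᵇ l) → count L (state k u v q ⊕ (s , l)) ≡ 0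
    clash l {u} {v} 2≤ = count-overlap L (suc k) (<⇒≤ s≤n) (subst (2 ≤_) (sym cell-k+1) 2≤)
      where
        cell-k+1 : (state k u v q ⊕ (s , l)) (suc k) ≡ bit v + bit (1 <ᵇ l)
        cell-k+1 = cong₂ _+_ (state-next k u v q s≤n) (cong bit (covers-behind n (suc k) 1 l (+-comm (suc k) 1) s≤n))

    count-place : ∀ l u v → l ≤ 3 → count L (state k u v q ⊕ (s , l)) ≡ value X (place l u v)
    count-place 0 true  v     _ = advance z≤n refl (+-identityʳ (bit v))
    count-place 0 false v     _ = stuck 0 (λ ())
    count-place 1 true  v     _ = advance (s≤s z≤n) refl (+-identityʳ (bit v))
    count-place 1 false v     _ = stuck 1 (λ ())
    count-place 2 true  true  _ = clash 2 ≤-refl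
    count-place 2 true  false _ = advance (s≤s (s≤s z≤n)) refl refl
    count-place 2 false v     _ = stuck 2 (λ ())
    count-place 3 true  v     _ = stuck 3 (λ ())
    count-place 3 false true  _ = clash 3 ≤-refl
    count-place 3 false false _ = advance ≤-refl refl refl
    count-place (suc (suc (suc (suc _)))) _ _ (s≤s (s≤s (s≤s ())))

    count-column : ∀ u v → count (columns s (suc d)) (state k u v q) ≡ coord (act (M s) X) u v
    count-column u v = begin
        count (arcsAt s ++ L) σ
      ≡⟨ count-exclusive (arcsAt s) L s s≤n (arcsAt-cover-end n s s≤n) ⟩
        count L σ + (a s * count L (σ ⊕ (s , 1)) + (b s * count L (σ ⊕ (s , 2)) + (c s * count L (σ ⊕ (s , 3)) + 0)))
      ≡⟨ cong₂ _+_ (trans (count-cong L (λ j _ → sym (+-identityʳ (σ j)))) (count-place 0 u v z≤n))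
          (cong₂ _+_ (cong (a s *_) (count-place 1 u v (s≤s z≤n)))
            (cong₂ _+_ (cong (b s *_) (count-place 2 u v (s≤s (s≤s z≤n))))
              (cong (λ t → c s * t + 0) (count-place 3 u v ≤-refl)))) ⟩
        value X (place 0 u v) + (a s * value X (place 1 u v)
          + (b s * value X (place 2 u v) + (c s * value X (place 3 u v) + 0)))
      ≡⟨ coord-factor (suc k) X u v ⟨
        coord (act (M s) X) u v
      ∎
      where
        σ : ℕ → ℕ
        σ = state k u v q

  count-state : ∀ d k q → suc k + d ≡ n → ∀ u v →
    count (columns (2 + k) d) (state k u v q) ≡ coord (applyFactors (2 + k) d (terminal q)) u v
  count-state zero    k q e = count-state-base k q (trans (sym (+-identityʳ (suc k))) e)
  count-state (suc d) k q e = ColumnStep.count-column k d q _ 2+k+d≡n (count-state d (suc k) q 2+k+d≡n)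
    where
      2+k+d≡n : 2 + k + d ≡ n
      2+k+d≡n = trans (sym (+-suc (suc k) d)) e

module Opening (a b c : ℕ → ℕ) (m : ℕ) where

  n : ℕ
  n = 2 + m

  open Circular a b c n public

  V : Bool → Vec3
  V q = applyFactors 2 (suc m) (terminal q)

  R₁ R₂ : List Arc
  R₁ = columns 1 n
  R₂ = columns 2 (suc m)

  after-column-0 : ∀ l → l ≤ 2 → ∀ j → j ≤ n → bit (covers n (0 , l) j) ≡ state 0 (0 <ᵇ l) false (1 <ᵇ l) j
  after-column-0 l l≤2 0 _ rewrite covers-behind n 0 0 l refl z≤n = sym (+-identityʳ (bit (0 <ᵇ l)))
  after-column-0 l l≤2 1 _ rewrite covers-ahead n 0 0 l | <ᵇ-false {n} (≤-trans l≤2 (m≤m+n 2 m)) = refl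
  after-column-0 l l≤2 (suc (suc t)) (s≤s (s≤s t≤m)) with m≤n⇒m<n∨m≡n t≤m
  ... | inj₁ t<m rewrite covers-ahead n 0 (suc t) l | pointAt-below (bit (1 <ᵇ l)) t<m
                       | <ᵇ-false {suc m ∸ t} (≤-trans l≤2 (m+n≤o⇒m≤o∸n 2 (s≤s t<m))) = refl
  ... | inj₂ refl rewrite covers-ahead n 0 (suc m) l | m+n∸n≡m 1 m = sym (pointAt-self m (bit (1 <ᵇ l)))

  after-column-1 : ∀ {u q u′ q′} l → l ≤ 3 →
    bit u + bit (1 <ᵇ l) ≡ bit u′ → bit q + bit (2 <ᵇ l) ≡ bit q′ →
    ∀ j → j ≤ n → (state 0 u false q ⊕ (1 , l)) j ≡ state 0 u′ (0 <ᵇ l) q′ j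
  after-column-1 {u} {u′ = u′} l l≤3 cell₀ cellₙ 0 _ rewrite covers-behind n 0 1 l refl (s≤s z≤n)
    = trans (cong (_+ bit (1 <ᵇ l)) (+-identityʳ (bit u))) (trans cell₀ (sym (+-identityʳ (bit u′))))
  after-column-1 l l≤3 cell₀ cellₙ 1 _ rewrite covers-behind n 1 0 l refl (s≤s z≤n)
    = sym (+-identityʳ (bit (0 <ᵇ l)))
  after-column-1 {q = q} {q′ = q′} l l≤3 cell₀ cellₙ (suc (suc t)) (s≤s (s≤s t≤m)) with m≤n⇒m<n∨m≡n t≤m
  ... | inj₁ t<m rewrite covers-ahead n 1 t l | pointAt-below (bit q) t<m | pointAt-below (bit q′) t<m
                       | <ᵇ-false {n ∸ t} (≤-trans l≤3 (m+n≤o⇒m≤o∸n 3 (s≤s (s≤s t<m)))) = refl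
  ... | inj₂ refl rewrite covers-ahead n 1 m l | m+n∸n≡m 2 m | pointAt-self m (bit q) | pointAt-self m (bit q′) = cellₙ

  count-after-column-1 : ∀ {u q u′ q′} l → l ≤ 3 →
    bit u + bit (1 <ᵇ l) ≡ bit u′ → bit q + bit (2 <ᵇ l) ≡ bit q′ →
    count R₂ (state 0 u false q ⊕ (1 , l)) ≡ coord (V q′) u′ (0 <ᵇ l)
  count-after-column-1 {u′ = u′} {q′} l l≤3 cell₀ cellₙ =
    trans (count-cong R₂ (after-column-1 l l≤3 cell₀ cellₙ)) (count-state (suc m) 0 q′ refl u′ (0 <ᵇ l))

  count-overlap-0 : ∀ q l → (1 <ᵇ l) ≡ true → count R₂ (state 0 true false q ⊕ (1 , l)) ≡ 0
  count-overlap-0 q l 1<l = count-overlap R₂ 0 z≤n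
    (subst (λ b → 2 ≤ 1 + 0 + bit b) (sym (trans (covers-behind n 0 1 l refl (s≤s z≤n)) 1<l)) ≤-refl)

  column-1-from-uncovered : count R₁ (state 0 false false false) ≡
    coord (V false) false false + (a 1 * coord (V false) false true
      + (b 1 * coord (V false) true true + (c 1 * coord (V true) true true + 0)))
  column-1-from-uncovered = trans (count-exclusive (arcsAt 1) R₂ 1 (s≤s z≤n) (arcsAt-cover-end n 1 (s≤s z≤n)))
    (cong₂ _+_ (count-state (suc m) 0 false refl false false)
      (cong₂ _+_ (cong (a 1 *_) (count-after-column-1 1 (s≤s z≤n) refl refl))
        (cong₂ _+_ (cong (b 1 *_) (count-after-column-1 2 (s≤s (s≤s z≤n)) refl refl))
          (cong (λ t → c 1 * t + 0) (count-after-column-1 3 ≤-refl refl refl)))))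

  column-1-from-covered : ∀ q → count R₁ (state 0 true false q) ≡
    coord (V q) true false + (a 1 * coord (V q) true true + (b 1 * 0 + (c 1 * 0 + 0)))
  column-1-from-covered q = trans (count-exclusive (arcsAt 1) R₂ 1 (s≤s z≤n) (arcsAt-cover-end n 1 (s≤s z≤n)))
    (cong₂ _+_ (count-state (suc m) 0 q refl true false)
      (cong₂ _+_ (cong (a 1 *_) (count-after-column-1 1 (s≤s z≤n) refl (+-identityʳ (bit q))))
        (cong₂ _+_ (cong (b 1 *_) (count-overlap-0 q 2 refl)) (cong (λ t → c 1 * t + 0) (count-overlap-0 q 3 refl)))))

  opening-algebra : ∀ V₀ V₁ →
    (coord V₀ false false + (a 1 * coord V₀ false true + (b 1 * coord V₀ true true + (c 1 * coord V₁ true true + 0))))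
      + (a 0 * (coord V₀ true false + (a 1 * coord V₀ true true + (b 1 * 0 + (c 1 * 0 + 0))))
        + (b 0 * (coord V₁ true false + (a 1 * coord V₁ true true + (b 1 * 0 + (c 1 * 0 + 0)))) + 0))
    ≡ proj₁ (act (M 0) (act (M 1) V₀)) + proj₁ (proj₂ (act (M 0) (act (M 1) V₁)))
  opening-algebra (x₀ , y₀ , z₀) (x₁ , y₁ , z₁) = identity (a 0) (b 0) (a 1) (b 1) (c 1) x₀ y₀ z₀ x₁ y₁ z₁
    where
      identity : ∀ α₀ β₀ α₁ β₁ γ₁ x₀ y₀ z₀ x₁ y₁ z₁ →
        (z₀ + (α₁ * 0 + (β₁ * x₀ + (γ₁ * x₁ + 0))))
          + (α₀ * (y₀ + (α₁ * x₀ + (β₁ * 0 + (γ₁ * 0 + 0))))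
            + (β₀ * (y₁ + (α₁ * x₁ + (β₁ * 0 + (γ₁ * 0 + 0)))) + 0))
        ≡ (α₀ * (α₁ * x₀ + (1 * y₀ + 0 * z₀))
            + (1 * (β₁ * x₀ + (0 * y₀ + 1 * z₀)) + 0 * (γ₁ * x₀ + (0 * y₀ + 0 * z₀))))
          + (β₀ * (α₁ * x₁ + (1 * y₁ + 0 * z₁))
            + (0 * (β₁ * x₁ + (0 * y₁ + 1 * z₁)) + 1 * (γ₁ * x₁ + (0 * y₁ + 0 * z₁))))
      identity = solve-∀

  count-opening : c 0 ≡ 0 → count (columns 0 (suc n)) (λ _ → 0) ≡
    proj₁ (act (M 0) (act (M 1) (V false))) + proj₁ (proj₂ (act (M 0) (act (M 1) (V true))))
  count-opening c₀≡0 = begin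
      count (arcsAt 0 ++ R₁) (λ _ → 0)
    ≡⟨ count-exclusive (arcsAt 0) R₁ 0 z≤n (arcsAt-cover-end n 0 z≤n) ⟩
      count R₁ (start 0) + (a 0 * count R₁ (start 1) + (b 0 * count R₁ (start 2) + (c 0 * count R₁ (start 3) + 0)))
    ≡⟨ cong₂ _+_ (enter 0 z≤n) (cong₂ _+_ (cong (a 0 *_) (enter 1 (s≤s z≤n)))
         (cong₂ _+_ (cong (b 0 *_) (enter 2 ≤-refl)) (cong (λ γ → γ * count R₁ (start 3) + 0) c₀≡0))) ⟩
      count R₁ (state 0 false false false)
        + (a 0 * count R₁ (state 0 true false false) + (b 0 * count R₁ (state 0 true false true) + 0))
    ≡⟨ cong₂ _+_ column-1-from-uncovered (cong₂ _+_ (cong (a 0 *_) (column-1-from-covered false))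
         (cong (λ t → b 0 * t + 0) (column-1-from-covered true))) ⟩
      _
    ≡⟨ opening-algebra (V false) (V true) ⟩
      proj₁ (act (M 0) (act (M 1) (V false))) + proj₁ (proj₂ (act (M 0) (act (M 1) (V true))))
    ∎
    where
      start : ℕ → ℕ → ℕ
      start l = (λ _ → 0) ⊕ (0 , l)
      enter : ∀ l → l ≤ 2 → count R₁ (start l) ≡ count R₁ (state 0 (0 <ᵇ l) false (1 <ᵇ l))
      enter l l≤2 = count-cong R₁ (after-column-0 l l≤2)

  A-value : A a b c n ≡ proj₁ (act (M 0) (act (M 1) (V false)))
  A-value = cong proj₁ (trans (sym (act-first-column (prodM a b c n))) (act-prodM n (1 , 0 , 0)))

  B-value : B a b c (suc m) ≡ proj₁ (proj₂ (act (M 0) (act (M 1) (V true))))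
  B-value = cong (proj₁ ∘ proj₂) (begin
    _                                              ≡⟨ act-first-column (prodM a b c (suc m)) ⟨
    act (prodM a b c (suc m)) (1 , 0 , 0)          ≡⟨ act-prodM (suc m) (1 , 0 , 0) ⟩
    act (M 0) (act (M 1) (applyFactors 2 m (1 , 0 , 0)))
      ≡⟨ cong (act (M 0) ∘ act (M 1) ∘ applyFactors 2 m) (act-factor-second-basis (suc m)) ⟨
    act (M 0) (act (M 1) (applyFactors 2 m (act (M (2 + m)) (0 , 1 , 0))))
      ≡⟨ cong (act (M 0) ∘ act (M 1)) (applyFactors-snoc 2 m (0 , 1 , 0)) ⟨
    act (M 0) (act (M 1) (V true))                 ∎)

mainTheorem3 : (n : ℕ) → 2 ≤ n → (a b c : ℕ → ℕ) → c 0 ≡ 0 →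
    tilings a b c n ≡ A a b c n + B a b c (n ∸ 1)
mainTheorem3 1 (s≤s ())
mainTheorem3 (suc (suc m)) _ a b c c₀≡0 = begin
  tilings a b c n                       ≡⟨ count-correct (allArcs n) ⟩
  count (allArcs n) (λ _ → 0)           ≡⟨ cong (λ L → count L (λ _ → 0)) (allArcs-columns n) ⟩
  count (columns 0 (suc n)) (λ _ → 0)   ≡⟨ count-opening c₀≡0 ⟩
  proj₁ (act (M 0) (act (M 1) (V false))) + proj₁ (proj₂ (act (M 0) (act (M 1) (V true))))
                                        ≡⟨ cong₂ _+_ A-value B-value ⟨
  A a b c n + B a b c (suc m)           ∎
  where open Opening a b c m
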